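{- For every integer $n \geq 3$, the independence number of the cubical staircase graph $CS_n$ is $$\alpha(CS_n) = \begin{cases} \dfrac{n^3-3n^2+2n}{12}, & n \text{ even},\\[2mm] \dfrac{n^3-3n^2+5n-3}{12}, & n \text{ odd}.\end{cases}$$
   Context: For a natural number $n \geq 3$, the cubical staircase graph $CS_n$ is the graph with vertex set $\{(i,j,k) : 1 \leq i \leq n-2,\ 1 \leq j \leq i,\ 1 \leq k \leq n-1-i\}$ and edge set consisting of the pairs $(i,j,k)(i,j,k+1)$ for $1\le i\le n-2$, $1\le j\le i$, $1\le k\le n-2-i$; the pairs $(i,j,k)(i+1,j,k)$ for $1\le i\le n-3$, $1\le j\le i$, $1\le k\le n-1-i$; and the pairs $(i,j,k)(i,j+1,k)$ for $1\le i\le n-2$, $1\le j\le i-1$, $1\le k\le n-1-i$ (only pairs of vertices of $CS_n$ are included). The independence number $\alpha(G)$ is the maximum size of a set of pairwise non-adjacent vertices of $G$. -}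

module Defs where

open import Data.Nat using (ℕ; suc; _+_; _*_; _∸_; _^_; _≤_; _%_; _/_)
open import Data.Nat.Base using (_≡ᵇ_)
open import Data.Bool using (if_then_else_)
open import Data.Product using (_×_; _,_; Σ)
open import Data.Sum using (_⊎_)
open import Data.List using (List; length)
open import Data.List.Membership.Propositional using (_∈_)
open import Data.List.Relation.Unary.All using (All)
open import Data.List.Relation.Unary.Unique.Propositional using (Unique)
open import Relation.Binary.PropositionalEquality using (_≡_)
open import Relation.Nullary using (¬_)

V : Set
V = ℕ × ℕ × ℕ

InCS : ℕ → V → Set
InCS n (i , j , k) = (1 ≤ i × i ≤ n ∸ 2) × (1 ≤ j × j ≤ i) × (1 ≤ k × k ≤ n ∸ 1 ∸ i)

data Step : V → V → Set where
  stepK : ∀ i j k → Step (i , j , k) (i , j , suc k)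
  stepI : ∀ i j k → Step (i , j , k) (suc i , j , k)
  stepJ : ∀ i j k → Step (i , j , k) (i , suc j , k)

Adj : ℕ → V → V → Set
Adj n u v = InCS n u × InCS n v × (Step u v ⊎ Step v u)

IsIndependent : ℕ → List V → Set
IsIndependent n S =
  Unique S × All (InCS n) S × (∀ {u v} → u ∈ S → v ∈ S → ¬ Adj n u v)

IsIndependenceNumber : ℕ → ℕ → Set
IsIndependenceNumber n m =
  Σ (List V) (λ S → IsIndependent n S × length S ≡ m)
  × (∀ S → IsIndependent n S → length S ≤ m)

alphaFormula : ℕ → ℕ
alphaFormula n =
  if n % 2 ≡ᵇ 0
  then (n ^ 3 + 2 * n ∸ 3 * n ^ 2) / 12
  else (n ^ 3 + 5 * n ∸ (3 * n ^ 2 + 3)) / 12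

{-# OPTIONS --safe #-}
-- Colour the vertex (i , j , k) by the parity of i + j + k.  Every edge changes one coordinate by
-- one, so the odd vertices form an independent set.  Conversely the even vertices can be matched
-- into the odd ones along edges: pair k with k + 1 for odd k, and where k is odd and maximal pair
-- j with j + 1 for odd j; only odd vertices (i , i , k) stay unmatched.  Sending each vertex to the
-- odd end of its matching edge is injective on an independent set, so no independent set beats
-- the odd vertices.  On the layer i + k = s the odd vertices are those whose j has parity opposite
-- to s; there are ⌊ s /2⌋ ^ 2 of them, and summing over s < n gives the formula.
module Submission where

open import Defs
open import Data.Nat
  using (ℕ; zero; suc; pred; _+_; _*_; _^_; _∸_; _/_; _≤_; _<_; z≤n; s≤s; s≤s⁻¹; _≤?_;
         parity; ⌊_/2⌋; ⌈_/2⌉)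
open import Data.Nat.Properties
open import Data.Nat.DivMod using (m*n/n≡m; m*n%n≡0; [m+kn]%n≡m%n)
open import Data.Nat.Tactic.RingSolver using (solve-∀)
open import Data.Parity.Base as ℙ using (Parity; 0ℙ; 1ℙ; _⁻¹)
import Data.Parity.Properties as ℙ
open import Data.Product using (_×_; _,_; _,′_; proj₁; proj₂; ∃-syntax; uncurry)
open import Data.Product.Properties using (,-injectiveʳ)
open import Data.Sum using (_⊎_; inj₁; inj₂; swap)
open import Data.List using (List; []; _∷_; _++_; map; length; filter; applyDownFrom)
open import Data.List.Properties using (length-map; length-++; length-removeAt′; filter-accept; filter-reject)
open import Data.List.Relation.Unary.Any using (here; there; _─_; index)
open import Data.List.Relation.Unary.All as All using (All)
import Data.List.Relation.Unary.All.Properties as All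
open import Data.List.Relation.Unary.AllPairs using ([]; _∷_)
open import Data.List.Relation.Unary.Unique.Propositional using (Unique)
open import Data.List.Relation.Unary.Unique.Propositional.Properties
  using (filter⁺; applyDownFrom⁺₁; map⁺; ++⁺)
open import Data.List.Relation.Binary.Disjoint.Propositional using (Disjoint)
open import Data.List.Relation.Binary.Subset.Propositional using (_⊆_)
open import Data.List.Membership.Propositional using (_∈_)
open import Data.List.Membership.Propositional.Properties
  using (∈-map⁺; ∈-map⁻; ∈-++⁺ˡ; ∈-++⁺ʳ; ∈-++⁻; ∈-filter⁻; ∈-filter⁺;
         ∈-applyDownFrom⁻; ∈-applyDownFrom⁺)
open import Function using (_∘_; _⇔_; mk⇔; Equivalence)
open import Relation.Binary.PropositionalEquality
open import Relation.Nullary using (¬_; yes; no; contradiction)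

module _ {A : Set} where

  ∈-─⁺ : ∀ {x y} {ys : List A} (x∈ys : x ∈ ys) → y ∈ ys → y ≢ x → y ∈ (ys ─ x∈ys)
  ∈-─⁺ (here refl)  (here refl)  y≢x = contradiction refl y≢x
  ∈-─⁺ (here _)     (there y∈ys) _   = y∈ys
  ∈-─⁺ (there _)    (here refl)  _   = here refl
  ∈-─⁺ (there x∈ys) (there y∈ys) y≢x = there (∈-─⁺ x∈ys y∈ys y≢x)

  Unique∧⊆⇒length≤ : ∀ {xs ys : List A} → Unique xs → xs ⊆ ys → length xs ≤ length ys
  Unique∧⊆⇒length≤ [] _ = z≤n
  Unique∧⊆⇒length≤ {x ∷ xs} {ys} (x∉xs ∷ xs!) xs⊆ys = begin
    suc (length xs)          ≤⟨ s≤s (Unique∧⊆⇒length≤ xs! xs⊆ys─x) ⟩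
    suc (length (ys ─ x∈ys)) ≡⟨ length-removeAt′ ys (index x∈ys) ⟨
    length ys                ∎
    where
    open ≤-Reasoning
    x∈ys = xs⊆ys (here refl)
    xs⊆ys─x : xs ⊆ (ys ─ x∈ys)
    xs⊆ys─x y∈xs = ∈-─⁺ x∈ys (xs⊆ys (there y∈xs)) (λ y≡x → All.lookup x∉xs y∈xs (sym y≡x))

  Unique-map⁺ : ∀ {B : Set} {f : A → B} {xs : List A} →
    (∀ {x y} → x ∈ xs → y ∈ xs → f x ≡ f y → x ≡ y) → Unique xs → Unique (map f xs)
  Unique-map⁺ _ [] = []
  Unique-map⁺ inj (x∉xs ∷ xs!) =
    All.map⁺ (All.tabulate λ y∈xs fx≡fy → All.lookup x∉xs y∈xs (inj (here refl) (there y∈xs) fx≡fy))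
    ∷ Unique-map⁺ (λ x∈xs y∈xs → inj (there x∈xs) (there y∈xs)) xs!

parity-suc : ∀ n → parity (suc n) ≡ parity n ⁻¹
parity-suc n = sym (ℙ.⁻¹-selfInverse (ℙ.suc-homo-⁻¹ n))

odd⇒suc-even : ∀ n → parity n ≡ 1ℙ → parity (suc n) ≡ 0ℙ
odd⇒suc-even n n-odd = trans (parity-suc n) (cong _⁻¹ n-odd)

suc-even⇒odd : ∀ n → parity (suc n) ≡ 0ℙ → parity n ≡ 1ℙ
suc-even⇒odd n sn-even = sym (ℙ.⁻¹-selfInverse (trans (sym (parity-suc n)) sn-even))

odd⇒nonZero : ∀ n → parity n ≡ 1ℙ → 1 ≤ n
odd⇒nonZero (suc n) _ = s≤s z≤n

parity[m+m+n]≡parity[n] : ∀ m n → parity (m + m + n) ≡ parity n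
parity[m+m+n]≡parity[n] m n = begin
  parity (m + m + n)           ≡⟨ ℙ.+-homo-+ (m + m) n ⟩
  parity (m + m) ℙ.+ parity n  ≡⟨ cong (ℙ._+ parity n) (trans (ℙ.+-homo-+ m m) (ℙ.p+p≡0ℙ (parity m))) ⟩
  parity n                     ∎
  where open ≡-Reasoning

weight : V → ℕ
weight (i , j , k) = i + j + k

IsOdd : V → Set
IsOdd v = parity (weight v) ≡ 1ℙ

Edge : V → V → Set
Edge u v = Step u v ⊎ Step v u

Step⇒weight≡suc : ∀ {u v} → Step u v → weight v ≡ suc (weight u)
Step⇒weight≡suc (stepK i j k) = +-suc (i + j) k
Step⇒weight≡suc (stepI i j k) = refl
Step⇒weight≡suc (stepJ i j k) = cong (_+ k) (+-suc i j)

Step⇒parity⁻¹ : ∀ {u v} → Step u v → parity (weight v) ≡ parity (weight u) ⁻¹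
Step⇒parity⁻¹ {u} step = trans (cong parity (Step⇒weight≡suc step)) (parity-suc (weight u))

Edge⇒parity⁻¹ : ∀ {u v} → Edge u v → parity (weight v) ≡ parity (weight u) ⁻¹
Edge⇒parity⁻¹ (inj₁ step) = Step⇒parity⁻¹ step
Edge⇒parity⁻¹ (inj₂ step) = sym (ℙ.⁻¹-selfInverse (sym (Step⇒parity⁻¹ step)))

Edge⇒¬both-odd : ∀ {u v} → Edge u v → IsOdd u → ¬ IsOdd v
Edge⇒¬both-odd edge u-odd v-odd =
  ℙ.p≢p⁻¹ 1ℙ (trans (sym v-odd) (trans (Edge⇒parity⁻¹ edge) (cong _⁻¹ u-odd)))

odd⇒independent : ∀ n {O} → Unique O → All (λ v → InCS n v × IsOdd v) O → IsIndependent n O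
odd⇒independent n O! O-odd = O! , All.map proj₁ O-odd , λ u∈O v∈O (_ , _ , edge) →
  Edge⇒¬both-odd edge (proj₂ (All.lookup O-odd u∈O)) (proj₂ (All.lookup O-odd v∈O))

partner : ℕ → V → V
partner n (i , j , k) with parity k | suc k ≤? n ∸ 1 ∸ i | parity j
... | 0ℙ | _     | _  = i , j , pred k
... | 1ℙ | yes _ | _  = i , j , suc k
... | 1ℙ | no _  | 1ℙ = i , suc j , k
... | 1ℙ | no _  | 0ℙ = i , pred j , k

module _ (n i j k : ℕ) where

  partner-k↓ : parity k ≡ 0ℙ → partner n (i , j , k) ≡ (i , j , pred k)
  partner-k↓ k-even rewrite k-even = refl

  partner-k↑ : parity k ≡ 1ℙ → suc k ≤ n ∸ 1 ∸ i → partner n (i , j , k) ≡ (i , j , suc k)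
  partner-k↑ k-odd below rewrite k-odd with suc k ≤? n ∸ 1 ∸ i
  ... | yes _ = refl
  ... | no ¬below = contradiction below ¬below

  partner-j↑ : parity k ≡ 1ℙ → ¬ suc k ≤ n ∸ 1 ∸ i → parity j ≡ 1ℙ →
               partner n (i , j , k) ≡ (i , suc j , k)
  partner-j↑ k-odd top j-odd rewrite k-odd | j-odd with suc k ≤? n ∸ 1 ∸ i
  ... | yes below = contradiction below top
  ... | no _      = refl

  partner-j↓ : parity k ≡ 1ℙ → ¬ suc k ≤ n ∸ 1 ∸ i → parity j ≡ 0ℙ →
               partner n (i , j , k) ≡ (i , pred j , k)
  partner-j↓ k-odd top j-even rewrite k-odd | j-even with suc k ≤? n ∸ 1 ∸ i
  ... | yes below = contradiction below top
  ... | no _      = refl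

partner-spec : ∀ n {v} → InCS n v → parity (weight v) ≡ 0ℙ →
  InCS n (partner n v) × Edge v (partner n v) × partner n (partner n v) ≡ v
partner-spec n {i , j , k} (i∈ , (1≤j , j≤i) , (1≤k , k≤)) v-even
  with parity k in k-parity | suc k ≤? n ∸ 1 ∸ i | parity j in j-parity
partner-spec n {i , j , suc k} (i∈ , j∈ , _ , k≤) _ | 0ℙ | _ | _ =
  (i∈ , j∈ , odd⇒nonZero k k-odd , ≤-trans (n≤1+n k) k≤) , inj₂ (stepK i j k) ,
  partner-k↑ n i j k k-odd k≤
  where k-odd = suc-even⇒odd k k-parity
... | 1ℙ | yes below | _ =
  (i∈ , (1≤j , j≤i) , s≤s z≤n , below) , inj₁ (stepK i j k) ,
  partner-k↓ n i j (suc k) (odd⇒suc-even k k-parity)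
... | 1ℙ | no top | 1ℙ =
  (i∈ , (s≤s z≤n , j<i) , 1≤k , k≤) , inj₁ (stepJ i j k) ,
  partner-j↓ n i (suc j) k k-parity top (odd⇒suc-even j j-parity)
  where
  j<i : j < i
  j<i = ≤∧≢⇒< j≤i λ { refl →
    ℙ.p≢p⁻¹ 1ℙ (trans (sym k-parity) (trans (sym (parity[m+m+n]≡parity[n] j k)) v-even)) }
partner-spec n {i , suc j , k} (i∈ , (_ , j<i) , k∈) _ | 1ℙ | no top | 0ℙ =
  (i∈ , (odd⇒nonZero j j-odd , ≤-trans (n≤1+n j) j<i) , k∈) , inj₂ (stepJ i j k) ,
  partner-j↑ n i j k k-parity top j-odd
  where j-odd = suc-even⇒odd j j-parity

oddMate : ℕ → V → V
oddMate n v with parity (weight v)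
... | 0ℙ = partner n v
... | 1ℙ = v

oddMate-odd : ∀ n {v} → InCS n v → InCS n (oddMate n v) × IsOdd (oddMate n v)
oddMate-odd n {v} v∈ with parity (weight v) in v-parity
... | 1ℙ = v∈ , v-parity
... | 0ℙ with w∈ , edge , _ ← partner-spec n v∈ v-parity =
  w∈ , trans (Edge⇒parity⁻¹ edge) (cong _⁻¹ v-parity)

oddMate-fibre : ∀ n {u v} → InCS n u → InCS n v → oddMate n u ≡ oddMate n v → u ≡ v ⊎ Edge u v
oddMate-fibre n {u} {v} u∈ v∈ same with parity (weight u) in u-parity | parity (weight v) in v-parity
... | 1ℙ | 1ℙ = inj₁ same
... | 1ℙ | 0ℙ with _ , edge , _ ← partner-spec n v∈ v-parity = inj₂ (swap (subst (Edge v) (sym same) edge))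
... | 0ℙ | 1ℙ with _ , edge , _ ← partner-spec n u∈ u-parity = inj₂ (subst (Edge u) same edge)
... | 0ℙ | 0ℙ with _ , _ , u-involution ← partner-spec n u∈ u-parity
                 with _ , _ , v-involution ← partner-spec n v∈ v-parity = inj₁ (begin
  u                       ≡⟨ u-involution ⟨
  partner n (partner n u) ≡⟨ cong (partner n) same ⟩
  partner n (partner n v) ≡⟨ v-involution ⟩
  v                       ∎)
  where open ≡-Reasoning

independent⇒length≤ : ∀ n {S O} → IsIndependent n S → (∀ {v} → InCS n v → IsOdd v → v ∈ O) →
  length S ≤ length O
independent⇒length≤ n {S} {O} (S! , S⊆CS , independent) odd⊆O = begin
  length S                   ≡⟨ length-map (oddMate n) S ⟨
  length (map (oddMate n) S) ≤⟨ Unique∧⊆⇒length≤ (Unique-map⁺ injective S!) image⊆O ⟩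
  length O                   ∎
  where
  open ≤-Reasoning
  injective : ∀ {u v} → u ∈ S → v ∈ S → oddMate n u ≡ oddMate n v → u ≡ v
  injective u∈S v∈S same with oddMate-fibre n (All.lookup S⊆CS u∈S) (All.lookup S⊆CS v∈S) same
  ... | inj₁ u≡v  = u≡v
  ... | inj₂ edge = contradiction (All.lookup S⊆CS u∈S , All.lookup S⊆CS v∈S , edge) (independent u∈S v∈S)
  image⊆O : map (oddMate n) S ⊆ O
  image⊆O w∈image with v , v∈S , refl ← ∈-map⁻ (oddMate n) w∈image =
    uncurry odd⊆O (oddMate-odd n (All.lookup S⊆CS v∈S))

ofParity : Parity → ℕ → List ℕ
ofParity p i = filter (λ j → parity j ℙ.≟ p) (applyDownFrom suc i)

∈-ofParity⁻ : ∀ p i {j} → j ∈ ofParity p i → (1 ≤ j × j ≤ i) × parity j ≡ p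
∈-ofParity⁻ p i j∈
  with j∈range , j-parity ← ∈-filter⁻ (λ j → parity j ℙ.≟ p) {xs = applyDownFrom suc i} j∈
  with j′ , j′<i , refl ← ∈-applyDownFrom⁻ suc j∈range = (s≤s z≤n , j′<i) , j-parity

∈-ofParity⁺ : ∀ {p i j} → 1 ≤ j → j ≤ i → parity j ≡ p → j ∈ ofParity p i
∈-ofParity⁺ {p} {j = suc j} _ j<i j-parity =
  ∈-filter⁺ (λ j → parity j ℙ.≟ p) (∈-applyDownFrom⁺ suc j<i) j-parity

ofParity-Unique : ∀ p i → Unique (ofParity p i)
ofParity-Unique p i = filter⁺ (λ j → parity j ℙ.≟ p)
  (applyDownFrom⁺₁ suc i λ j<k _ → <⇒≢ j<k ∘ sym ∘ suc-injective)

ofParity-suc-reject : ∀ c → ofParity (parity c) (suc c) ≡ ofParity (parity c) c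
ofParity-suc-reject c = filter-reject (λ j → parity j ℙ.≟ parity c) {suc c} {applyDownFrom suc c}
  λ same → ℙ.p≢p⁻¹ (parity c) (sym (trans (sym (parity-suc c)) same))

ofParity-suc-suc : ∀ c → ofParity (parity c) (2 + c) ≡ 2 + c ∷ ofParity (parity c) c
ofParity-suc-suc c =
  trans (filter-accept (λ j → parity j ℙ.≟ parity c) {2 + c} {applyDownFrom suc (suc c)} refl)
        (cong (2 + c ∷_) (ofParity-suc-reject c))

length-ofParity : ∀ c → length (ofParity (parity c) c) ≡ ⌈ c /2⌉
length-ofParity zero          = refl
length-ofParity (suc zero)    = refl
length-ofParity (suc (suc c)) = trans (cong length (ofParity-suc-suc c)) (cong suc (length-ofParity c))

triangle : Parity → ℕ → List (ℕ × ℕ)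
triangle p zero    = []
triangle p (suc c) = map (suc c ,′_) (ofParity p (suc c)) ++ triangle p c

∈-triangle⁻ : ∀ {p c i j} → (i , j) ∈ triangle p c → (1 ≤ j × j ≤ i) × i ≤ c × parity j ≡ p
∈-triangle⁻ {p} {suc c} ij∈ with ∈-++⁻ (map (suc c ,′_) (ofParity p (suc c))) ij∈
... | inj₁ ij∈column with j , j∈ , refl ← ∈-map⁻ (suc c ,′_) ij∈column
                     with j∈range , j-parity ← ∈-ofParity⁻ p (suc c) j∈ = j∈range , ≤-refl , j-parity
... | inj₂ ij∈rest with j∈range , i≤c , j-parity ← ∈-triangle⁻ ij∈rest =
  j∈range , m≤n⇒m≤1+n i≤c , j-parity

∈-triangle⁺ : ∀ {p c i j} → 1 ≤ j → j ≤ i → i ≤ c → parity j ≡ p → (i , j) ∈ triangle p c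
∈-triangle⁺ {c = zero} _ (s≤s _) () _
∈-triangle⁺ {p} {suc c} 1≤j j≤i i≤c j-parity with m≤n⇒m<n∨m≡n i≤c
... | inj₁ i<c  =
  ∈-++⁺ʳ (map (suc c ,′_) (ofParity p (suc c))) (∈-triangle⁺ 1≤j j≤i (s≤s⁻¹ i<c) j-parity)
... | inj₂ refl = ∈-++⁺ˡ (∈-map⁺ (suc c ,′_) (∈-ofParity⁺ 1≤j j≤i j-parity))

triangle-Unique : ∀ p c → Unique (triangle p c)
triangle-Unique p zero    = []
triangle-Unique p (suc c) =
  ++⁺ (map⁺ ,-injectiveʳ (ofParity-Unique p (suc c))) (triangle-Unique p c) column∩rest≡∅
  where
  column∩rest≡∅ : Disjoint (map (suc c ,′_) (ofParity p (suc c))) (triangle p c)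
  column∩rest≡∅ (v∈column , v∈rest) with j , _ , refl ← ∈-map⁻ (suc c ,′_) v∈column
                                     with _ , 1+c≤c , _ ← ∈-triangle⁻ v∈rest = 1+n≰n 1+c≤c

length-triangle-suc : ∀ p c → length (triangle p (suc c)) ≡ length (ofParity p (suc c)) + length (triangle p c)
length-triangle-suc p c = trans (length-++ (map (suc c ,′_) (ofParity p (suc c))))
  (cong (_+ length (triangle p c)) (length-map (suc c ,′_) (ofParity p (suc c))))

length-triangle : ∀ c → length (triangle (parity c) c) ≡ ⌈ c /2⌉ * ⌈ c /2⌉
length-triangle zero          = refl
length-triangle (suc zero)    = refl
length-triangle (suc (suc c)) = begin
  length (triangle p (2 + c))
    ≡⟨ trans (length-triangle-suc p (suc c)) (cong (length (ofParity p (2 + c)) +_) (length-triangle-suc p c)) ⟩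
  length (ofParity p (2 + c)) + (length (ofParity p (1 + c)) + length (triangle p c))
    ≡⟨ cong₂ (λ a b → a + (b + length (triangle p c)))
             (length-ofParity (2 + c)) (cong length (ofParity-suc-reject c)) ⟩
  suc h + (length (ofParity p c) + length (triangle p c))
    ≡⟨ cong₂ (λ a b → suc h + (a + b)) (length-ofParity c) (length-triangle c) ⟩
  suc h + (h + h * h)
    ≡⟨ square-suc h ⟩
  suc h * suc h
    ∎
  where
  open ≡-Reasoning
  p = parity c
  h = ⌈ c /2⌉
  square-suc : ∀ h → suc h + (h + h * h) ≡ suc h * suc h
  square-suc = solve-∀

odd⇔middle-parity : ∀ i j k → IsOdd (i , j , k) ⇔ (parity j ≡ parity (i + k) ⁻¹)
odd⇔middle-parity i j k = mk⇔
  (λ odd → ℙ.+-cancelʳ-≡ q _ _ (trans (sym weight-parity) (trans odd (sym (ℙ.p⁻¹+p≡1ℙ q)))))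
  (λ j-parity → trans weight-parity (trans (cong (ℙ._+ q) j-parity) (ℙ.p⁻¹+p≡1ℙ q)))
  where
  q = parity (i + k)
  weight-parity : parity (i + j + k) ≡ parity j ℙ.+ q
  weight-parity = trans (cong parity (trans (cong (_+ k) (+-comm i j)) (+-assoc j i k))) (ℙ.+-homo-+ j (i + k))

onLayer : ℕ → ℕ × ℕ → V
onLayer s (i , j) = i , j , s ∸ i

layer : ℕ → List V
layer s = map (onLayer s) (triangle (parity s ⁻¹) (pred s))

∈-layer⁻ : ∀ {s i j k} → (i , j , k) ∈ layer s →
           (1 ≤ j × j ≤ i) × (1 ≤ k × i + k ≡ s) × IsOdd (i , j , k)
∈-layer⁻ {suc s} v∈ with (i , j) , ij∈ , refl ← ∈-map⁻ (onLayer (suc s)) v∈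
                    with j∈ , i≤s , j-parity ← ∈-triangle⁻ ij∈ =
  j∈ , (m<n⇒0<n∸m (s≤s i≤s) , i+[1+s∸i]≡1+s) ,
  Equivalence.from (odd⇔middle-parity i j (suc s ∸ i))
    (subst (λ t → parity j ≡ parity t ⁻¹) (sym i+[1+s∸i]≡1+s) j-parity)
  where
  i+[1+s∸i]≡1+s : i + (suc s ∸ i) ≡ suc s
  i+[1+s∸i]≡1+s = m+[n∸m]≡n (m≤n⇒m≤1+n i≤s)

∈-layer⁺ : ∀ {i j k} → 1 ≤ j → j ≤ i → 1 ≤ k → IsOdd (i , j , k) → (i , j , k) ∈ layer (i + k)
∈-layer⁺ {i} {j} {k} 1≤j j≤i 1≤k odd = subst (λ t → (i , j , t) ∈ layer (i + k)) (m+n∸m≡n i k)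
  (∈-map⁺ (onLayer (i + k))
    (∈-triangle⁺ 1≤j j≤i (<⇒≤pred (m<m+n i 1≤k)) (Equivalence.to (odd⇔middle-parity i j k) odd)))

layer-Unique : ∀ s → Unique (layer s)
layer-Unique s = map⁺ onLayer-injective (triangle-Unique (parity s ⁻¹) (pred s))
  where
  onLayer-injective : ∀ {a b} → onLayer s a ≡ onLayer s b → a ≡ b
  onLayer-injective refl = refl

oddVertices : ℕ → List V
oddVertices zero    = []
oddVertices (suc n) = oddVertices n ++ layer n

InCS′ : ℕ → V → Set
InCS′ n (i , j , k) = (1 ≤ j × j ≤ i) × (1 ≤ k × i + k < n)

module _ (n : ℕ) {i j k : ℕ} where

  private
    k+1+i≡1+i+k : k + suc i ≡ suc (i + k)
    k+1+i≡1+i+k = trans (+-suc k i) (cong suc (+-comm k i))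

    n∸1∸i≡n∸[1+i] : n ∸ 1 ∸ i ≡ n ∸ suc i
    n∸1∸i≡n∸[1+i] = ∸-+-assoc n 1 i

  InCS′⇒InCS : InCS′ n (i , j , k) → InCS n (i , j , k)
  InCS′⇒InCS ((1≤j , j≤i) , 1≤k , i+k<n) =
    (≤-trans 1≤j j≤i , m+n≤o⇒m≤o∸n i i+2≤n) , (1≤j , j≤i) , (1≤k , k≤n∸1∸i)
    where
    i+2≤n : i + 2 ≤ n
    i+2≤n = ≤-trans (+-monoʳ-≤ i (s≤s 1≤k)) (≤-trans (≤-reflexive (+-suc i k)) i+k<n)
    k≤n∸1∸i : k ≤ n ∸ 1 ∸ i
    k≤n∸1∸i = subst (k ≤_) (sym n∸1∸i≡n∸[1+i])
                (m+n≤o⇒m≤o∸n k (subst (_≤ n) (sym k+1+i≡1+i+k) i+k<n))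

  InCS⇒InCS′ : InCS n (i , j , k) → InCS′ n (i , j , k)
  InCS⇒InCS′ (_ , j∈ , (1≤k , k≤n∸1∸i)) =
    j∈ , 1≤k , subst (_≤ n) k+1+i≡1+i+k (m≤o∸n⇒m+n≤o k 1+i≤n k≤n∸[1+i])
    where
    k≤n∸[1+i] : k ≤ n ∸ suc i
    k≤n∸[1+i] = subst (k ≤_) n∸1∸i≡n∸[1+i] k≤n∸1∸i
    1+i≤n : suc i ≤ n
    1+i≤n = <⇒≤ (m∸n≢0⇒n<m (m<n⇒n≢0 (≤-trans 1≤k k≤n∸[1+i])))

∈-oddVertices⁻ : ∀ n {v} → v ∈ oddVertices n → InCS′ n v × IsOdd v
∈-oddVertices⁻ (suc n) v∈ with ∈-++⁻ (oddVertices n) v∈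
... | inj₁ v∈odd   with (j∈ , 1≤k , i+k<n) , odd ← ∈-oddVertices⁻ n v∈odd =
  (j∈ , 1≤k , m<n⇒m<1+n i+k<n) , odd
... | inj₂ v∈layer with j∈ , (1≤k , refl) , odd ← ∈-layer⁻ v∈layer =
  (j∈ , 1≤k , ≤-refl) , odd

∈-oddVertices⁺ : ∀ n {v} → InCS′ n v → IsOdd v → v ∈ oddVertices n
∈-oddVertices⁺ (suc n) {i , j , k} ((1≤j , j≤i) , 1≤k , i+k<1+n) odd with m<1+n⇒m<n∨m≡n i+k<1+n
... | inj₁ i+k<n = ∈-++⁺ˡ (∈-oddVertices⁺ n ((1≤j , j≤i) , 1≤k , i+k<n) odd)
... | inj₂ refl  = ∈-++⁺ʳ (oddVertices (i + k)) (∈-layer⁺ 1≤j j≤i 1≤k odd)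

∈-oddVertices⇔ : ∀ n {v} → v ∈ oddVertices n ⇔ (InCS n v × IsOdd v)
∈-oddVertices⇔ n {i , j , k} = mk⇔
  (λ v∈ → let v∈′ , odd = ∈-oddVertices⁻ n v∈ in InCS′⇒InCS n v∈′ , odd)
  (λ (v∈ , odd) → ∈-oddVertices⁺ n (InCS⇒InCS′ n v∈) odd)

oddVertices-Unique : ∀ n → Unique (oddVertices n)
oddVertices-Unique zero    = []
oddVertices-Unique (suc n) = ++⁺ (oddVertices-Unique n) (layer-Unique n) below∩layer≡∅
  where
  below∩layer≡∅ : Disjoint (oddVertices n) (layer n)
  below∩layer≡∅ {i , j , k} (v∈odd , v∈layer)
    with (_ , _ , i+k<n) , _ ← ∈-oddVertices⁻ n v∈odd
    with _ , (_ , i+k≡n) , _ ← ∈-layer⁻ v∈layer = <-irrefl i+k≡n i+k<n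

length-layer : ∀ s → length (layer s) ≡ ⌊ s /2⌋ * ⌊ s /2⌋
length-layer zero    = refl
length-layer (suc c) = begin
  length (layer (suc c))                   ≡⟨ length-map (onLayer (suc c)) (triangle (parity (suc c) ⁻¹) c) ⟩
  length (triangle (parity (suc c) ⁻¹) c)  ≡⟨ cong (λ p → length (triangle p c)) (ℙ.suc-homo-⁻¹ c) ⟩
  length (triangle (parity c) c)           ≡⟨ length-triangle c ⟩
  ⌈ c /2⌉ * ⌈ c /2⌉                        ∎
  where open ≡-Reasoning

length-oddVertices-suc : ∀ n → length (oddVertices (suc n)) ≡ length (oddVertices n) + ⌊ n /2⌋ * ⌊ n /2⌋
length-oddVertices-suc n = trans (length-++ (oddVertices n)) (cong (length (oddVertices n) +_) (length-layer n))

⌊m*2/2⌋≡m : ∀ m → ⌊ m * 2 /2⌋ ≡ m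
⌊m*2/2⌋≡m zero    = refl
⌊m*2/2⌋≡m (suc m) = cong suc (⌊m*2/2⌋≡m m)

⌊1+m*2/2⌋≡m : ∀ m → ⌊ 1 + m * 2 /2⌋ ≡ m
⌊1+m*2/2⌋≡m zero    = refl
⌊1+m*2/2⌋≡m (suc m) = cong suc (⌊1+m*2/2⌋≡m m)

length-oddVertices-odd  : ∀ m → 12 * length (oddVertices (1 + m * 2)) ≡ 8 * (m * m * m) + 4 * m
length-oddVertices-even : ∀ m → 12 * length (oddVertices (m * 2)) + 12 * (m * m) ≡ 8 * (m * m * m) + 4 * m

length-oddVertices-odd m = begin
  12 * length (oddVertices (1 + m * 2))  ≡⟨ cong (12 *_) (length-oddVertices-suc (m * 2)) ⟩
  12 * (l + ⌊ m * 2 /2⌋ * ⌊ m * 2 /2⌋)  ≡⟨ cong (λ q → 12 * (l + q * q)) (⌊m*2/2⌋≡m m) ⟩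
  12 * (l + m * m)                       ≡⟨ *-distribˡ-+ 12 l (m * m) ⟩
  12 * l + 12 * (m * m)                  ≡⟨ length-oddVertices-even m ⟩
  8 * (m * m * m) + 4 * m                ∎
  where
  open ≡-Reasoning
  l = length (oddVertices (m * 2))

length-oddVertices-even zero    = refl
length-oddVertices-even (suc m) = begin
  12 * length (oddVertices (2 + m * 2)) + 12 * (suc m * suc m)
    ≡⟨ cong (λ x → 12 * x + 12 * (suc m * suc m)) (length-oddVertices-suc (1 + m * 2)) ⟩
  12 * (l + ⌊ 1 + m * 2 /2⌋ * ⌊ 1 + m * 2 /2⌋) + 12 * (suc m * suc m)
    ≡⟨ cong (λ q → 12 * (l + q * q) + 12 * (suc m * suc m)) (⌊1+m*2/2⌋≡m m) ⟩
  12 * (l + m * m) + 12 * (suc m * suc m)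
    ≡⟨ regroup l m ⟩
  12 * l + (24 * (m * m) + 24 * m + 12)
    ≡⟨ cong (_+ (24 * (m * m) + 24 * m + 12)) (length-oddVertices-odd m) ⟩
  8 * (m * m * m) + 4 * m + (24 * (m * m) + 24 * m + 12)
    ≡⟨ expand m ⟩
  8 * (suc m * suc m * suc m) + 4 * suc m
    ∎
  where
  open ≡-Reasoning
  l = length (oddVertices (1 + m * 2))
  regroup : ∀ x y → 12 * (x + y * y) + 12 * (suc y * suc y) ≡ 12 * x + (24 * (y * y) + 24 * y + 12)
  regroup = solve-∀
  expand : ∀ y → 8 * (y * y * y) + 4 * y + (24 * (y * y) + 24 * y + 12) ≡ 8 * (suc y * suc y * suc y) + 4 * suc y
  expand = solve-∀

12*q+r≡s⇒[s∸r]/12≡q : ∀ {q r s} → 12 * q + r ≡ s → (s ∸ r) / 12 ≡ q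
12*q+r≡s⇒[s∸r]/12≡q {q} {r} refl = begin
  (12 * q + r ∸ r) / 12  ≡⟨ cong (_/ 12) (m+n∸n≡m (12 * q) r) ⟩
  (12 * q) / 12          ≡⟨ cong (_/ 12) (*-comm 12 q) ⟩
  (q * 12) / 12          ≡⟨ m*n/n≡m q 12 ⟩
  q                      ∎
  where open ≡-Reasoning

n^2≡n*n : ∀ n → n ^ 2 ≡ n * n
n^2≡n*n n = cong (n *_) (*-identityʳ n)

n^3≡n*n*n : ∀ n → n ^ 3 ≡ n * n * n
n^3≡n*n*n n = trans (cong (n *_) (n^2≡n*n n)) (sym (*-assoc n n n))

-- The ring solver does not see through ℕ's _^_, hence the detour through n^2≡n*n and n^3≡n*n*n.
alphaFormula-even : ∀ m {l} → 12 * l + 12 * (m * m) ≡ 8 * (m * m * m) + 4 * m → alphaFormula (m * 2) ≡ l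
alphaFormula-even m {l} count rewrite m*n%n≡0 m 2 ⦃ _ ⦄ = 12*q+r≡s⇒[s∸r]/12≡q (begin
  12 * l + 3 * n ^ 2       ≡⟨ cong (λ x → 12 * l + 3 * x) (n^2≡n*n n) ⟩
  12 * l + 3 * (n * n)     ≡⟨ cong (12 * l +_) (square m) ⟩
  12 * l + 12 * (m * m)    ≡⟨ count ⟩
  8 * (m * m * m) + 4 * m  ≡⟨ cube m ⟩
  n * n * n + 2 * n        ≡⟨ cong (_+ 2 * n) (n^3≡n*n*n n) ⟨
  n ^ 3 + 2 * n            ∎)
  where
  open ≡-Reasoning
  n = m * 2
  square : ∀ m → 3 * (m * 2 * (m * 2)) ≡ 12 * (m * m)
  square = solve-∀
  cube : ∀ m → 8 * (m * m * m) + 4 * m ≡ m * 2 * (m * 2) * (m * 2) + 2 * (m * 2)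
  cube = solve-∀

alphaFormula-odd : ∀ m {l} → 12 * l ≡ 8 * (m * m * m) + 4 * m → alphaFormula (1 + m * 2) ≡ l
alphaFormula-odd m {l} count rewrite [m+kn]%n≡m%n 1 m 2 ⦃ _ ⦄ = 12*q+r≡s⇒[s∸r]/12≡q (begin
  12 * l + (3 * n ^ 2 + 3)                               ≡⟨ cong (λ x → 12 * l + (3 * x + 3)) (n^2≡n*n n) ⟩
  12 * l + (3 * (n * n) + 3)                             ≡⟨ cong (12 * l +_) (square m) ⟩
  12 * l + (12 * (m * m) + 12 * m + 6)                   ≡⟨ cong (_+ (12 * (m * m) + 12 * m + 6)) count ⟩
  8 * (m * m * m) + 4 * m + (12 * (m * m) + 12 * m + 6)  ≡⟨ cube m ⟩
  n * n * n + 5 * n                                      ≡⟨ cong (_+ 5 * n) (n^3≡n*n*n n) ⟨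
  n ^ 3 + 5 * n                                          ∎)
  where
  open ≡-Reasoning
  n = 1 + m * 2
  square : ∀ m → 3 * ((1 + m * 2) * (1 + m * 2)) + 3 ≡ 12 * (m * m) + 12 * m + 6
  square = solve-∀
  cube : ∀ m → 8 * (m * m * m) + 4 * m + (12 * (m * m) + 12 * m + 6)
             ≡ (1 + m * 2) * (1 + m * 2) * (1 + m * 2) + 5 * (1 + m * 2)
  cube = solve-∀

even⊎odd : ∀ n → ∃[ m ] (n ≡ m * 2 ⊎ n ≡ 1 + m * 2)
even⊎odd zero = 0 , inj₁ refl
even⊎odd (suc n) with even⊎odd n
... | m , inj₁ refl = m , inj₂ refl
... | m , inj₂ refl = suc m , inj₁ refl

length-oddVertices≡alphaFormula : ∀ n → length (oddVertices n) ≡ alphaFormula n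
length-oddVertices≡alphaFormula n with even⊎odd n
... | m , inj₁ refl = sym (alphaFormula-even m (length-oddVertices-even m))
... | m , inj₂ refl = sym (alphaFormula-odd m (length-oddVertices-odd m))

theorem6 : (n : ℕ) → 3 ≤ n → IsIndependenceNumber n (alphaFormula n)
theorem6 n _ = (oddVertices n , oddVertices-independent , length-oddVertices≡alphaFormula n) , maximum
  where
  oddVertices-independent : IsIndependent n (oddVertices n)
  oddVertices-independent =
    odd⇒independent n (oddVertices-Unique n) (All.tabulate (Equivalence.to (∈-oddVertices⇔ n)))
  maximum : ∀ S → IsIndependent n S → length S ≤ alphaFormula n
  maximum S independent = subst (length S ≤_) (length-oddVertices≡alphaFormula n)
    (independent⇒length≤ n independent (λ v∈ odd → Equivalence.from (∈-oddVertices⇔ n) (v∈ , odd)))
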